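{- For every $k\in\mathbb{N}$, $$\sum_{n\ge0}S^o[n,k]\frac{x^n}{[n]!}=\frac{1}{q^{\binom k2}}\sum_{i=0}^k(-1)^{k-i}q^{\binom{k-i}{2}}\begin{bmatrix}k\\ i\end{bmatrix}\exp_q([i]x),$$ and $$\sum_{n,k\ge0}S^o[n,k]t^k\frac{x^n}{[n]!}=\sum_{i=0}^\infty\frac{q^it^i}{(1+t)(q+t)\cdots(q^i+t)}\exp_q([i]x).$$
   Context: $q,x,t$ are indeterminates; $[m]=(1-q^m)/(1-q)$, $[m]!=[m][m-1]\cdots[1]$ ($[0]!=1$), $\begin{bmatrix}k\\ i\end{bmatrix}=\frac{[k]!}{[i]![k-i]!}$, and $\exp_q(x)=\sum_{n\ge0}x^n/[n]!$. The $q$-Stirling numbers of the second kind are defined by $S[0,k]=\delta_{0,k}$ ($k\in\mathbb{Z}$) and $S[n,k]=S[n-1,k-1]+[k]S[n-1,k]$ for $n\ge1$; the ordered version is $S^o[n,k]=[k]!\,S[n,k]$. Both identities are identities of formal power series (in $x$, resp. in $x$ and $t$) with coefficients rational functions of $q$; on the right side of the second identity, each summand is expanded as a power series in $t$ (it is divisible by $t^i$). -}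

module Defs where

import Level
open import Level using (Level; _⊔_)
open import Algebra.Bundles using (CommutativeRing)
open import Data.Nat using (ℕ; zero; suc; _∸_; _≤?_)
open import Data.Nat.Combinatorics using (_C_)
open import Data.Integer using (ℤ; +_; -[1+_])
open import Data.List using (List; []; _∷_)
open import Data.List.Relation.Unary.Any using (Any)
open import Data.Bool using (if_then_else_)
open import Data.Product using (_×_)
open import Relation.Nullary using (¬_)
open import Relation.Nullary.Decidable using (⌊_⌋)
open import Relation.Binary.PropositionalEquality using (_≢_)

module IntPoly {c ℓ : Level} (R : CommutativeRing c ℓ) where
  open CommutativeRing R hiding (zero)

  natR : ℕ → Carrier
  natR zero    = 0#
  natR (suc n) = 1# + natR n

  intR : ℤ → Carrier
  intR (+ n)     = natR n
  intR -[1+ n ]  = - natR (suc n)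

  evalPoly : List ℤ → Carrier → Carrier
  evalPoly []       x = 0#
  evalPoly (a ∷ as) x = intR a + x * evalPoly as x

  NonzeroPoly : List ℤ → Set
  NonzeroPoly as = Any (λ a → a ≢ + 0) as

-- The subfield generated by q is then ℚ(q).
record QSetting (c ℓ : Level) : Set (Level.suc (c ⊔ ℓ)) where
  field
    cring : CommutativeRing c ℓ
  open CommutativeRing cring public hiding (zero)
  open IntPoly cring public
  field
    _⁻¹      : Carrier → Carrier
    inverseʳ : ∀ x → ¬ (x ≈ 0#) → x * (x ⁻¹) ≈ 1#
    q        : Carrier
    transcendental : ∀ (p : List ℤ) → NonzeroPoly p → ¬ (evalPoly p q ≈ 0#)

module Ops {c ℓ : Level} (F : QSetting c ℓ) where
  open QSetting F

  pow : Carrier → ℕ → Carrier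
  pow x zero    = 1#
  pow x (suc n) = x * pow x n

  qnum : ℕ → Carrier
  qnum m = (1# - pow q m) * (1# - q) ⁻¹

  qfact : ℕ → Carrier
  qfact zero    = 1#
  qfact (suc m) = qnum (suc m) * qfact m

  -- q-binomial [k choose i] = [k]!/([i]![k-i]!)  (used for i ≤ k)
  qbinom : ℕ → ℕ → Carrier
  qbinom k i = qfact k * (qfact i * qfact (k ∸ i)) ⁻¹

  -- q-Stirling numbers of the second kind S[n,k] for k ∈ ℕ
  -- (S[n,k] = 0 for k < 0, so S[n,-1] = 0 in the recursion for k = 0).
  S : ℕ → ℕ → Carrier
  S zero    zero    = 1#
  S zero    (suc k) = 0#
  S (suc n) zero    = 0# + qnum 0 * S n zero
  S (suc n) (suc k) = S n k + qnum (suc k) * S n (suc k)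

  So : ℕ → ℕ → Carrier
  So n k = qfact k * S n k

  sumTo : ℕ → (ℕ → Carrier) → Carrier
  sumTo zero    f = f zero
  sumTo (suc m) f = sumTo m f + f (suc m)

  Series : Set c
  Series = ℕ → Carrier

  _≋_ : Series → Series → Set ℓ
  f ≋ g = ∀ n → f n ≈ g n

  scale : Carrier → Series → Series
  scale a f n = a * f n

  sumS : ℕ → (ℕ → Series) → Series
  sumS k G n = sumTo k (λ i → G i n)

  mulS : Series → Series → Series
  mulS f g m = sumTo m (λ j → f j * g (m ∸ j))

  prodS : ℕ → (ℕ → Series) → Series
  prodS zero    G = G zero
  prodS (suc i) G = mulS (prodS i G) (G (suc i))

  mono : Carrier → ℕ → Series
  mono a i m = if ⌊ m Data.Nat.≟ i ⌋ then a else 0#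

  linS : Carrier → Series
  linS a zero          = a
  linS a (suc zero)    = 1#
  linS a (suc (suc m)) = 0#

  -- inverse of a series with invertible constant term:
  -- b₀ = a₀⁻¹,  b_{m+1} = - a₀⁻¹ Σ_{j=0}^{m} a_{m+1-j} b_j.
  -- invApprox f m j = b_j for j ≤ m.
  invApprox : Series → ℕ → ℕ → Carrier
  invApprox f zero    j = f 0 ⁻¹
  invApprox f (suc m) j =
    if ⌊ j ≤? m ⌋ then invApprox f m j
    else - (f 0 ⁻¹ * sumTo m (λ l → f (suc m ∸ l) * invApprox f m l))

  invS : Series → Series
  invS f m = invApprox f m m

  expq : Carrier → Series
  expq c n = pow c n * qfact n ⁻¹

  -- formal power series in x and t: F n k = coefficient of x^n t^k
  Series2 : Set c
  Series2 = ℕ → ℕ → Carrier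

  _≋₂_ : Series2 → Series2 → Set ℓ
  f ≋₂ g = ∀ n k → f n k ≈ g n k

  tensor : Series → Series → Series2
  tensor ft gx n k = ft k * gx n

  -- Σ_{i ≥ 0} G i for a family with G i divisible by t^i (t-adically
  -- convergent): the coefficient of x^n t^k only receives terms i ≤ k.
  sumInf : (ℕ → Series2) → Series2
  sumInf G n k = sumTo k (λ i → G i n k)

  lhs1 : ℕ → Series
  lhs1 k n = So n k * qfact n ⁻¹

  rhs1 : ℕ → Series
  rhs1 k = scale (pow q (k C 2) ⁻¹)
             (sumS k (λ i → scale (pow (- 1#) (k ∸ i) * pow q ((k ∸ i) C 2) * qbinom k i)
                                  (expq (qnum i))))

  lhs2 : Series2
  lhs2 n k = So n k * qfact n ⁻¹

  rhs2 : Series2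
  rhs2 = sumInf (λ i →
           tensor (mulS (mono (pow q i) i) (invS (prodS i (λ j → linS (pow q j)))))
                  (expq (qnum i)))

{-# OPTIONS --safe #-}
-- Let c(i,j) = (-1)^j q^C(j,2) / ([i]! [j]!) and E(n,k) = Σ_{i≤k} c(i,k-i) [i]^n.
-- Splitting [k+1] = [k+1-i] + q^(k+1-i) [i] makes [k+1] E(0,k+1) telescope to 0,
-- and gives E(n+1,k+1) = [k+1] E(n,k+1) + q^k E(n,k): the recurrence of
-- q^C(k,2) S[n,k].  Hence E(n,k) = q^C(k,2) S[n,k], which is the first identity.
-- For the second, the coefficient of t^m in 1/((1+t)(q+t)⋯(q^i+t)) is
-- (-1)^m q^C(m,2) [i+m]! / (q^i q^C(i+m,2) [i]! [m]!): by induction on i, these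
-- coefficients times (1+t)⋯(q^i+t) give 1, and inverse series are unique.  So
-- the coefficient of t^k x^n on the right is that of the first identity for k.
module Submission where

open import Defs
open import Level using (Level)
open import Algebra.Bundles using (CommutativeRing)
open import Data.Nat as ℕ using (ℕ; zero; suc; _≤_; z≤n; s≤s; s≤s⁻¹; _∸_; _≤?_)
import Data.Nat.Properties as ℕP
open import Data.Nat.Combinatorics using (_C_; nC1≡n; nCk+nC[k+1]≡[n+1]C[k+1])
open import Data.Integer as ℤ using (ℤ; +_; -[1+_]; _⊖_; sign; ∣_∣; _◃_)
import Data.Integer.Properties as ℤP
open import Data.Sign as Sign using (Sign)
open import Data.List using (List; []; _∷_)
open import Data.List.Relation.Unary.Any using (here; there)
open import Data.Maybe using (Maybe; just; nothing)
open import Data.Product using (_×_; _,_)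
open import Data.Sum using (inj₁; inj₂)
open import Data.Empty using (⊥-elim)
open import Relation.Nullary using (¬_; yes; no)
import Relation.Binary.PropositionalEquality as P
import Algebra.Solver.Ring.AlmostCommutativeRing as ACR

module IntegerCoefficients {c ℓ : Level} (R : CommutativeRing c ℓ) where
  open CommutativeRing R hiding (zero)

  -- Unlike IntPoly.natR, natR 1 reduces to 1#, so that the solver constants
  -- con (+ 1) and con -[1+ 0 ] are definitionally 1# and - 1#.
  natR : ℕ → Carrier
  natR zero          = 0#
  natR (suc zero)    = 1#
  natR (suc (suc n)) = 1# + natR (suc n)

  natR-suc : ∀ n → natR (suc n) ≈ 1# + natR n
  natR-suc zero    = sym (+-identityʳ _)
  natR-suc (suc n) = refl

  intR : ℤ → Carrier
  intR (+ n)    = natR n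
  intR -[1+ n ] = - natR (suc n)
  open import Algebra.Properties.Ring ring using (-‿involutive; -‿distribˡ-*; -0#≈0#; -‿+-comm)
  open import Relation.Binary.Reasoning.Setoid setoid

  natR-+ : ∀ m n → natR (m ℕ.+ n) ≈ natR m + natR n
  natR-+ zero    n = sym (+-identityˡ _)
  natR-+ (suc m) n = begin
    natR (suc (m ℕ.+ n))       ≈⟨ natR-suc (m ℕ.+ n) ⟩
    1# + natR (m ℕ.+ n)        ≈⟨ +-congˡ (natR-+ m n) ⟩
    1# + (natR m + natR n)     ≈⟨ +-assoc _ _ _ ⟨
    (1# + natR m) + natR n     ≈⟨ +-congʳ (natR-suc m) ⟨
    natR (suc m) + natR n      ∎

  natR-* : ∀ m n → natR (m ℕ.* n) ≈ natR m * natR n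
  natR-* zero    n = sym (zeroˡ _)
  natR-* (suc m) n = begin
    natR (n ℕ.+ m ℕ.* n)          ≈⟨ natR-+ n (m ℕ.* n) ⟩
    natR n + natR (m ℕ.* n)       ≈⟨ +-cong (sym (*-identityˡ _)) (natR-* m n) ⟩
    1# * natR n + natR m * natR n ≈⟨ distribʳ _ _ _ ⟨
    (1# + natR m) * natR n        ≈⟨ *-congʳ (natR-suc m) ⟨
    natR (suc m) * natR n         ∎

  intR-⊖ : ∀ m n → intR (m ⊖ n) ≈ natR m - natR n
  intR-⊖ m zero = begin
    intR (m ⊖ 0) ≡⟨ P.cong intR (ℤP.⊖-≥ {m} {0} z≤n) ⟩
    natR m       ≈⟨ +-identityʳ _ ⟨
    natR m + 0#  ≈⟨ +-congˡ -0#≈0# ⟨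
    natR m - 0#  ∎
  intR-⊖ zero (suc n) = begin
    intR (0 ⊖ suc n)   ≡⟨ P.cong intR (ℤP.⊖-≤ {0} {suc n} z≤n) ⟩
    - natR (suc n)     ≈⟨ +-identityˡ _ ⟨
    0# - natR (suc n)  ∎
  intR-⊖ (suc m) (suc n) = begin
    intR (suc m ⊖ suc n)          ≡⟨ P.cong intR (ℤP.[1+m]⊖[1+n]≡m⊖n m n) ⟩
    intR (m ⊖ n)                  ≈⟨ intR-⊖ m n ⟩
    natR m - natR n               ≈⟨ +-congʳ (+-identityˡ _) ⟨
    (0# + natR m) - natR n        ≈⟨ +-congʳ (+-congʳ (-‿inverseʳ 1#)) ⟨
    ((1# - 1#) + natR m) - natR n ≈⟨ +-congʳ (+-assoc _ _ _) ⟩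
    (1# + (- 1# + natR m)) - natR n ≈⟨ +-congʳ (+-congˡ (+-comm _ _)) ⟩
    (1# + (natR m - 1#)) - natR n ≈⟨ +-congʳ (+-assoc _ _ _) ⟨
    ((1# + natR m) - 1#) - natR n ≈⟨ +-assoc _ _ _ ⟩
    (1# + natR m) + (- 1# - natR n) ≈⟨ +-congˡ (-‿+-comm _ _) ⟩
    (1# + natR m) - (1# + natR n) ≈⟨ +-cong (natR-suc m) (-‿cong (natR-suc n)) ⟨
    natR (suc m) - natR (suc n)   ∎

  intR-+ : ∀ i j → intR (i ℤ.+ j) ≈ intR i + intR j
  intR-+ (+ m)    (+ n)    = natR-+ m n
  intR-+ (+ m)    -[1+ n ] = intR-⊖ m (suc n)
  intR-+ -[1+ m ] (+ n)    = trans (intR-⊖ n (suc m)) (+-comm _ _)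
  intR-+ -[1+ m ] -[1+ n ] = begin
    - natR (suc (suc (m ℕ.+ n)))             ≈⟨ -‿cong (natR-suc (suc (m ℕ.+ n))) ⟩
    - (1# + natR (suc m ℕ.+ n))              ≈⟨ -‿cong (+-congˡ (natR-+ (suc m) n)) ⟩
    - (1# + (natR (suc m) + natR n))         ≈⟨ -‿cong (+-congˡ (+-comm _ _)) ⟩
    - (1# + (natR n + natR (suc m)))         ≈⟨ -‿cong (+-assoc _ _ _) ⟨
    - ((1# + natR n) + natR (suc m))         ≈⟨ -‿cong (+-congʳ (natR-suc n)) ⟨
    - (natR (suc n) + natR (suc m))          ≈⟨ -‿+-comm _ _ ⟨
    - natR (suc n) - natR (suc m)            ≈⟨ +-comm _ _ ⟩
    - natR (suc m) - natR (suc n)            ∎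

  intR-neg : ∀ i → intR (ℤ.- i) ≈ - intR i
  intR-neg (+ zero)  = sym -0#≈0#
  intR-neg (+ suc n) = refl
  intR-neg -[1+ n ]  = sym (-‿involutive _)

  signR : Sign → Carrier
  signR Sign.+ = 1#
  signR Sign.- = - 1#

  signR-* : ∀ s t → signR (s Sign.* t) ≈ signR s * signR t
  signR-* Sign.- Sign.- = sym (trans (sym (-‿distribˡ-* 1# (- 1#))) (trans (-‿cong (*-identityˡ _)) (-‿involutive _)))
  signR-* Sign.- Sign.+ = sym (*-identityʳ _)
  signR-* Sign.+ Sign.- = sym (*-identityˡ _)
  signR-* Sign.+ Sign.+ = sym (*-identityˡ _)

  intR-◃ : ∀ s n → intR (s ◃ n) ≈ signR s * natR n
  intR-◃ Sign.- zero    = sym (zeroʳ _)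
  intR-◃ Sign.+ zero    = sym (zeroʳ _)
  intR-◃ Sign.+ (suc n) = sym (*-identityˡ _)
  intR-◃ Sign.- (suc n) = trans (-‿cong (sym (*-identityˡ _))) (-‿distribˡ-* _ _)

  intR-* : ∀ i j → intR (i ℤ.* j) ≈ intR i * intR j
  intR-* i j = begin
    intR (i ℤ.* j)                                    ≈⟨ intR-◃ (sign i Sign.* sign j) (∣ i ∣ ℕ.* ∣ j ∣) ⟩
    signR (sign i Sign.* sign j) * natR (∣ i ∣ ℕ.* ∣ j ∣) ≈⟨ *-cong (signR-* (sign i) (sign j)) (natR-* ∣ i ∣ ∣ j ∣) ⟩
    (signR (sign i) * signR (sign j)) * (natR ∣ i ∣ * natR ∣ j ∣) ≈⟨ interchange _ _ _ _ ⟩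
    (signR (sign i) * natR ∣ i ∣) * (signR (sign j) * natR ∣ j ∣) ≈⟨ *-cong (decompose i) (decompose j) ⟨
    intR i * intR j                                   ∎
    where
    open import Algebra.Properties.CommutativeSemigroup *-commutativeSemigroup using (interchange)
    decompose : ∀ i → intR i ≈ signR (sign i) * natR ∣ i ∣
    decompose i = trans (reflexive (P.cong intR (P.sym (ℤP.◃-inverse i)))) (intR-◃ (sign i) ∣ i ∣)

  intR-homomorphism : ACR._-Raw-AlmostCommutative⟶_ ℤ.+-*-rawRing (ACR.fromCommutativeRing R)
  intR-homomorphism = record
    { ⟦_⟧ = intR ; +-homo = intR-+ ; *-homo = intR-* ; -‿homo = intR-neg
    ; 0-homo = refl ; 1-homo = refl }

  intR-≟ : ∀ i j → Maybe (intR i ≈ intR j)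
  intR-≟ i j with i ℤ.≟ j
  ... | yes i≡j = just (reflexive (P.cong intR i≡j))
  ... | no _    = nothing

  open import Algebra.Solver.Ring ℤ.+-*-rawRing (ACR.fromCommutativeRing R) intR-homomorphism intR-≟ public

module Field {c ℓ : Level} (R : CommutativeRing c ℓ) where
  open CommutativeRing R
  open import Relation.Binary.Reasoning.Setoid setoid

  Nonzero : Carrier → Set ℓ
  Nonzero x = ¬ (x ≈ 0#)

  module PartialInverse (_⁻¹ : Carrier → Carrier) (inverseʳ : ∀ x → Nonzero x → x * x ⁻¹ ≈ 1#)
                        (1≉0 : Nonzero 1#) where

    inverseˡ : ∀ x → Nonzero x → x ⁻¹ * x ≈ 1#
    inverseˡ x x≉0 = trans (*-comm _ _) (inverseʳ x x≉0)

    nonzero-resp-≈ : ∀ {x y} → x ≈ y → Nonzero x → Nonzero y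
    nonzero-resp-≈ x≈y x≉0 y≈0 = x≉0 (trans x≈y y≈0)

    *-cancelʳ : ∀ {x y z} → Nonzero z → x * z ≈ y * z → x ≈ y
    *-cancelʳ {x} {y} {z} z≉0 xz≈yz = begin
      x                ≈⟨ *-identityʳ _ ⟨
      x * 1#           ≈⟨ *-congˡ (inverseʳ z z≉0) ⟨
      x * (z * z ⁻¹)   ≈⟨ *-assoc _ _ _ ⟨
      (x * z) * z ⁻¹   ≈⟨ *-congʳ xz≈yz ⟩
      (y * z) * z ⁻¹   ≈⟨ *-assoc _ _ _ ⟩
      y * (z * z ⁻¹)   ≈⟨ *-congˡ (inverseʳ z z≉0) ⟩
      y * 1#           ≈⟨ *-identityʳ _ ⟩
      y                ∎

    *-nonzero : ∀ {x y} → Nonzero x → Nonzero y → Nonzero (x * y)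
    *-nonzero {x} {y} x≉0 y≉0 xy≈0 = y≉0 (*-cancelʳ x≉0 (trans (*-comm y x) (trans xy≈0 (sym (zeroˡ x)))))

    nonzero-*-zero : ∀ {z x} → Nonzero z → z * x ≈ 0# → x ≈ 0#
    nonzero-*-zero z≉0 zx≈0 = *-cancelʳ z≉0 (trans (*-comm _ _) (trans zx≈0 (sym (zeroˡ _))))

    ⁻¹-unique : ∀ {x y} → Nonzero x → x * y ≈ 1# → x ⁻¹ ≈ y
    ⁻¹-unique {x} {y} x≉0 xy≈1 = *-cancelʳ x≉0 (trans (inverseˡ x x≉0) (trans (sym xy≈1) (*-comm _ _)))

    ⁻¹-nonzero : ∀ {x} → Nonzero x → Nonzero (x ⁻¹)
    ⁻¹-nonzero {x} x≉0 x⁻¹≈0 = 1≉0 (trans (sym (inverseʳ x x≉0)) (trans (*-congˡ x⁻¹≈0) (zeroʳ _)))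

    ⁻¹-cong : ∀ {x y} → Nonzero x → x ≈ y → x ⁻¹ ≈ y ⁻¹
    ⁻¹-cong {x} {y} x≉0 x≈y = ⁻¹-unique x≉0 (trans (*-congʳ x≈y) (inverseʳ y (nonzero-resp-≈ x≈y x≉0)))

    1⁻¹≈1 : 1# ⁻¹ ≈ 1#
    1⁻¹≈1 = ⁻¹-unique 1≉0 (*-identityʳ _)

    ⁻¹-* : ∀ {x y} → Nonzero x → Nonzero y → (x * y) ⁻¹ ≈ x ⁻¹ * y ⁻¹
    ⁻¹-* {x} {y} x≉0 y≉0 = ⁻¹-unique (*-nonzero x≉0 y≉0) (begin
      (x * y) * (x ⁻¹ * y ⁻¹) ≈⟨ *-assoc _ _ _ ⟩
      x * (y * (x ⁻¹ * y ⁻¹)) ≈⟨ *-congˡ (x∙yz≈y∙xz _ _ _) ⟩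
      x * (x ⁻¹ * (y * y ⁻¹)) ≈⟨ *-assoc _ _ _ ⟨
      (x * x ⁻¹) * (y * y ⁻¹) ≈⟨ *-cong (inverseʳ x x≉0) (inverseʳ y y≉0) ⟩
      1# * 1#                 ≈⟨ *-identityʳ _ ⟩
      1#                      ∎)
      where open import Algebra.Properties.CommutativeSemigroup *-commutativeSemigroup using (x∙yz≈y∙xz)

    ⁻¹-factor : ∀ {u v w} → Nonzero u → Nonzero v → w ≈ u * v → u ⁻¹ ≈ v * w ⁻¹
    ⁻¹-factor {u} {v} {w} u≉0 v≉0 w≈uv = begin
      u ⁻¹                ≈⟨ *-identityˡ _ ⟨
      1# * u ⁻¹           ≈⟨ *-congʳ (inverseʳ v v≉0) ⟨
      (v * v ⁻¹) * u ⁻¹   ≈⟨ *-assoc _ _ _ ⟩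
      v * (v ⁻¹ * u ⁻¹)   ≈⟨ *-congˡ (*-comm _ _) ⟩
      v * (u ⁻¹ * v ⁻¹)   ≈⟨ *-congˡ (⁻¹-* u≉0 v≉0) ⟨
      v * (u * v) ⁻¹      ≈⟨ *-congˡ (⁻¹-cong (*-nonzero u≉0 v≉0) (sym w≈uv)) ⟩
      v * w ⁻¹            ∎

module QNumbers {c ℓ : Level} (F : QSetting c ℓ) where
  open QSetting F
  open Ops F
  open import Algebra.Properties.Ring ring using (-‿distribʳ-*)
  open import Relation.Binary.Reasoning.Setoid setoid
  open IntegerCoefficients cring using (solve; _:=_; con; _:-_; _:+_; _:*_)

  1≉0 : ¬ (1# ≈ 0#)
  1≉0 1≈0 = transcendental (+ 1 ∷ []) (here (λ ())) (begin
    (1# + 0#) + q * 0# ≈⟨ +-cong (+-identityʳ _) (zeroʳ _) ⟩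
    1# + 0#            ≈⟨ +-identityʳ _ ⟩
    1#                 ≈⟨ 1≈0 ⟩
    0#                 ∎)

  open Field cring using (Nonzero) public
  open Field.PartialInverse cring _⁻¹ inverseʳ 1≉0 public

  q≉0 : Nonzero q
  q≉0 q≈0 = transcendental (+ 0 ∷ + 1 ∷ []) (there (here (λ ())))
    (trans (+-identityˡ _) (trans (*-congʳ q≈0) (zeroˡ _)))

  pow-+ : ∀ x m n → pow x (m ℕ.+ n) ≈ pow x m * pow x n
  pow-+ x zero    n = sym (*-identityˡ _)
  pow-+ x (suc m) n = trans (*-congˡ (pow-+ x m n)) (sym (*-assoc _ _ _))

  pow-nonzero : ∀ {x} → Nonzero x → ∀ n → Nonzero (pow x n)
  pow-nonzero x≉0 zero    = 1≉0
  pow-nonzero x≉0 (suc n) = *-nonzero x≉0 (pow-nonzero x≉0 n)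

  pow-q-suc-C2 : ∀ m → pow q (suc m C 2) ≈ pow q m * pow q (m C 2)
  pow-q-suc-C2 m = trans (reflexive (P.cong (pow q) [1+m]C2≡m+mC2)) (pow-+ q m (m C 2))
    where
    [1+m]C2≡m+mC2 : suc m C 2 P.≡ m ℕ.+ m C 2
    [1+m]C2≡m+mC2 = P.trans (P.sym (nCk+nC[k+1]≡[n+1]C[k+1] m 1)) (P.cong (ℕ._+ m C 2) (nC1≡n m))

  negMonomial : ℕ → List ℤ
  negMonomial zero    = -[1+ 0 ] ∷ []
  negMonomial (suc m) = + 0 ∷ negMonomial m

  evalPoly-negMonomial : ∀ m → evalPoly (negMonomial m) q ≈ - pow q m
  evalPoly-negMonomial zero    = trans (+-cong (-‿cong (+-identityʳ _)) (zeroʳ _)) (+-identityʳ _)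
  evalPoly-negMonomial (suc m) = trans (+-identityˡ _)
    (trans (*-congˡ (evalPoly-negMonomial m)) (sym (-‿distribʳ-* _ _)))

  1-q^[1+m]≉0 : ∀ m → Nonzero (1# - pow q (suc m))
  1-q^[1+m]≉0 m ≈0 = transcendental (+ 1 ∷ negMonomial m) (here (λ ())) (begin
    (1# + 0#) + q * evalPoly (negMonomial m) q ≈⟨ +-cong (+-identityʳ _) (*-congˡ (evalPoly-negMonomial m)) ⟩
    1# + q * - pow q m                         ≈⟨ +-congˡ (-‿distribʳ-* _ _) ⟨
    1# - pow q (suc m)                         ≈⟨ ≈0 ⟩
    0#                                         ∎)

  qnum-nonzero : ∀ m → Nonzero (qnum (suc m))
  qnum-nonzero m = *-nonzero (1-q^[1+m]≉0 m)
    (⁻¹-nonzero (nonzero-resp-≈ (+-congˡ (-‿cong (*-identityʳ q))) (1-q^[1+m]≉0 0)))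

  qfact-nonzero : ∀ m → Nonzero (qfact m)
  qfact-nonzero zero    = 1≉0
  qfact-nonzero (suc m) = *-nonzero (qnum-nonzero m) (qfact-nonzero m)

  qnum-0 : qnum 0 ≈ 0#
  qnum-0 = trans (*-congʳ (-‿inverseʳ 1#)) (zeroˡ _)

  qnum-+ : ∀ i j → qnum (i ℕ.+ j) ≈ qnum i + pow q i * qnum j
  qnum-+ i j = begin
    (1# - pow q (i ℕ.+ j)) * u  ≈⟨ *-congʳ (+-congˡ (-‿cong (pow-+ q i j))) ⟩
    (1# - pow q i * pow q j) * u
      ≈⟨ solve 3 (λ a b u → (con (+ 1) :- a :* b) :* u := (con (+ 1) :- a) :* u :+ a :* ((con (+ 1) :- b) :* u))
               refl (pow q i) (pow q j) u ⟩
    qnum i + pow q i * qnum j   ∎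
    where u = (1# - q) ⁻¹

module FiniteSums {c ℓ : Level} (F : QSetting c ℓ) where
  open QSetting F
  open Ops F
  open import Relation.Binary.Reasoning.Setoid setoid
  open import Algebra.Properties.CommutativeSemigroup +-commutativeSemigroup using (interchange)

  sumTo-cong≤ : ∀ k {f g : ℕ → Carrier} → (∀ i → i ≤ k → f i ≈ g i) → sumTo k f ≈ sumTo k g
  sumTo-cong≤ zero    f≈g = f≈g 0 z≤n
  sumTo-cong≤ (suc k) f≈g = +-cong (sumTo-cong≤ k (λ i i≤k → f≈g i (ℕP.m≤n⇒m≤1+n i≤k))) (f≈g (suc k) ℕP.≤-refl)

  sumTo-cong : ∀ k {f g : ℕ → Carrier} → (∀ i → f i ≈ g i) → sumTo k f ≈ sumTo k g
  sumTo-cong k f≈g = sumTo-cong≤ k (λ i _ → f≈g i)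

  sumTo-+ : ∀ k (f g : ℕ → Carrier) → sumTo k (λ i → f i + g i) ≈ sumTo k f + sumTo k g
  sumTo-+ zero    f g = refl
  sumTo-+ (suc k) f g = trans (+-congʳ (sumTo-+ k f g)) (interchange _ _ _ _)

  sumTo-*ˡ : ∀ k a (f : ℕ → Carrier) → a * sumTo k f ≈ sumTo k (λ i → a * f i)
  sumTo-*ˡ zero    a f = refl
  sumTo-*ˡ (suc k) a f = trans (distribˡ _ _ _) (+-congʳ (sumTo-*ˡ k a f))

  sumTo-*ʳ : ∀ k a (f : ℕ → Carrier) → sumTo k f * a ≈ sumTo k (λ i → f i * a)
  sumTo-*ʳ zero    a f = refl
  sumTo-*ʳ (suc k) a f = trans (distribʳ _ _ _) (+-congʳ (sumTo-*ʳ k a f))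

  sumTo-zero : ∀ k (f : ℕ → Carrier) → (∀ i → i ≤ k → f i ≈ 0#) → sumTo k f ≈ 0#
  sumTo-zero k f f≈0 = trans (sumTo-cong≤ k f≈0) (sumTo-0# k)
    where
    sumTo-0# : ∀ k → sumTo k (λ _ → 0#) ≈ 0#
    sumTo-0# zero    = refl
    sumTo-0# (suc k) = trans (+-identityʳ _) (sumTo-0# k)

  sumTo-suc-head : ∀ k (f : ℕ → Carrier) → sumTo (suc k) f ≈ f 0 + sumTo k (λ i → f (suc i))
  sumTo-suc-head zero    f = refl
  sumTo-suc-head (suc k) f = trans (+-congʳ (sumTo-suc-head k f)) (+-assoc _ _ _)

  sumTo-reverse : ∀ k (f : ℕ → Carrier) → sumTo k f ≈ sumTo k (λ j → f (k ∸ j))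
  sumTo-reverse zero    f = refl
  sumTo-reverse (suc k) f = begin
    sumTo k f + f (suc k)                  ≈⟨ +-comm _ _ ⟩
    f (suc k) + sumTo k f                  ≈⟨ +-congˡ (sumTo-reverse k f) ⟩
    f (suc k) + sumTo k (λ j → f (k ∸ j))  ≈⟨ sumTo-suc-head k (λ j → f (suc k ∸ j)) ⟨
    sumTo (suc k) (λ j → f (suc k ∸ j))    ∎

  sumTo-single : ∀ k i (f : ℕ → Carrier) → i ≤ k → (∀ j → j P.≢ i → f j ≈ 0#) → sumTo k f ≈ f i
  sumTo-single zero    .zero f z≤n f≈0 = refl
  sumTo-single (suc k) i    f i≤ f≈0 with ℕP.m≤n⇒m<n∨m≡n i≤
  ... | inj₁ i<1+k = trans (+-cong (sumTo-single k i f (s≤s⁻¹ i<1+k) f≈0)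
                                   (f≈0 (suc k) (λ 1+k≡i → ℕP.<-irrefl (P.sym 1+k≡i) i<1+k)))
                           (+-identityʳ _)
  ... | inj₂ P.refl = trans (+-congʳ (sumTo-zero k f (λ j j≤k → f≈0 j (λ j≡i → ℕP.<-irrefl j≡i (s≤s j≤k)))))
                            (+-identityˡ _)

module ExplicitFormula {c ℓ : Level} (F : QSetting c ℓ) where
  open QSetting F
  open Ops F
  open QNumbers F
  open FiniteSums F
  open IntegerCoefficients cring using (solve; _:=_; con; _:+_; _:*_)
  open import Relation.Binary.Reasoning.Setoid setoid

  -- q^C(k,2) [k]! stirlingCoeff i (k ∸ i) is the coefficient of exp_q([i]x) in rhs1 k.
  stirlingCoeff : ℕ → ℕ → Carrier
  stirlingCoeff i j = pow (- 1#) j * pow q (j C 2) * (qfact i * qfact j) ⁻¹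

  stirlingSum : ℕ → ℕ → Carrier
  stirlingSum n k = sumTo k (λ i → stirlingCoeff i (k ∸ i) * pow (qnum i) n)

  stirlingCoeff-suc : ∀ i m → stirlingCoeff i (suc m) ≈
    ((- 1# * pow (- 1#) m) * (pow q m * pow q (m C 2))) * (qfact i * (qnum (suc m) * qfact m)) ⁻¹
  stirlingCoeff-suc i m = *-congʳ (*-congˡ (pow-q-suc-C2 m))

  stirlingCoeff-*-qnum : ∀ i m → stirlingCoeff i (suc m) * qnum i ≈
    qnum (i ℕ.+ suc m) * stirlingCoeff i (suc m) + pow q (i ℕ.+ m) * stirlingCoeff i m
  stirlingCoeff-*-qnum i m = begin
    stirlingCoeff i (suc m) * ni ≈⟨ *-congʳ (stirlingCoeff-suc i m) ⟩
    (((- 1# * σ) * (qm * Q)) * D) * ni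
      ≈⟨ solve 7 (λ σ qm Q D ni qi ns →
           (((con -[1+ 0 ] :* σ) :* (qm :* Q)) :* D) :* ni
           := (ni :+ qi :* ns) :* (((con -[1+ 0 ] :* σ) :* (qm :* Q)) :* D) :+ (qi :* qm) :* ((σ :* Q) :* (ns :* D)))
           refl σ qm Q D ni qi ns ⟩
    (ni + qi * ns) * (((- 1# * σ) * (qm * Q)) * D) + (qi * qm) * ((σ * Q) * (ns * D))
      ≈⟨ +-cong (*-cong (sym (qnum-+ i (suc m))) (sym (stirlingCoeff-suc i m)))
                (*-cong (sym (pow-+ q i m)) (*-congˡ ns*D≈)) ⟩
    qnum (i ℕ.+ suc m) * stirlingCoeff i (suc m) + pow q (i ℕ.+ m) * stirlingCoeff i m ∎
    where
    σ = pow (- 1#) m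
    qm = pow q m
    Q = pow q (m C 2)
    D = (qfact i * (qnum (suc m) * qfact m)) ⁻¹
    ni = qnum i
    qi = pow q i
    ns = qnum (suc m)
    ns*D≈ : ns * D ≈ (qfact i * qfact m) ⁻¹
    ns*D≈ = sym (⁻¹-factor (*-nonzero (qfact-nonzero i) (qfact-nonzero m)) (qnum-nonzero m)
      (solve 3 (λ a b e → a :* (b :* e) := (a :* e) :* b) refl (qfact i) ns (qfact m)))

  stirlingCoeff-recurrence : ∀ i k → i ≤ k →
    stirlingCoeff i (suc k ∸ i) * qnum i ≈
      qnum (suc k) * stirlingCoeff i (suc k ∸ i) + pow q k * stirlingCoeff i (k ∸ i)
  stirlingCoeff-recurrence i k i≤k with ℕP.m≤n⇒∃[o]m+o≡n i≤k
  ... | m , P.refl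
    rewrite P.trans (P.cong (_∸ i) (P.sym (ℕP.+-suc i m))) (ℕP.m+n∸m≡n i (suc m))
          | ℕP.m+n∸m≡n i m
    = trans (stirlingCoeff-*-qnum i m) (+-congʳ (*-congʳ (reflexive (P.cong qnum (ℕP.+-suc i m)))))

  stirlingCoeff-cancel : ∀ j m →
    qnum (suc m) * stirlingCoeff j (suc m) + pow q m * qnum (suc j) * stirlingCoeff (suc j) m ≈ 0#
  stirlingCoeff-cancel j m = begin
    ns * stirlingCoeff j (suc m) + qm * nj * (σ * Q * D′)
      ≈⟨ +-congʳ (*-congˡ (stirlingCoeff-suc j m)) ⟩
    ns * (((- 1# * σ) * (qm * Q)) * D) + qm * nj * (σ * Q * D′)
      ≈⟨ solve 7 (λ ns σ qm Q D nj D′ →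
           ns :* (((con -[1+ 0 ] :* σ) :* (qm :* Q)) :* D) :+ qm :* nj :* (σ :* Q :* D′)
           := (con -[1+ 0 ] :* σ :* qm :* Q) :* (ns :* D) :+ (σ :* qm :* Q) :* (nj :* D′))
           refl ns σ qm Q D nj D′ ⟩
    (- 1# * σ * qm * Q) * (ns * D) + (σ * qm * Q) * (nj * D′)
      ≈⟨ +-cong (*-congˡ (cancel (qnum-nonzero m)
                  (solve 3 (λ a b e → a :* (b :* e) := (a :* e) :* b) refl (qfact j) ns (qfact m))))
                (*-congˡ (cancel (qnum-nonzero j)
                  (solve 3 (λ a b e → (b :* a) :* e := (a :* e) :* b) refl (qfact j) nj (qfact m)))) ⟩
    (- 1# * σ * qm * Q) * E + (σ * qm * Q) * E
      ≈⟨ solve 4 (λ σ qm Q E → (con -[1+ 0 ] :* σ :* qm :* Q) :* E :+ (σ :* qm :* Q) :* E := con (+ 0))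
               refl σ qm Q E ⟩
    0# ∎
    where
    σ = pow (- 1#) m
    qm = pow q m
    Q = pow q (m C 2)
    ns = qnum (suc m)
    nj = qnum (suc j)
    D = (qfact j * (ns * qfact m)) ⁻¹
    D′ = ((nj * qfact j) * qfact m) ⁻¹
    E = (qfact j * qfact m) ⁻¹
    cancel : ∀ {b w} → Nonzero b → w ≈ (qfact j * qfact m) * b → b * w ⁻¹ ≈ E
    cancel b≉0 w≈ = sym (⁻¹-factor (*-nonzero (qfact-nonzero j) (qfact-nonzero m)) b≉0 w≈)

  stirlingSum-0-suc : ∀ k → stirlingSum 0 (suc k) ≈ 0#
  stirlingSum-0-suc k = nonzero-*-zero (qnum-nonzero k) (begin
    [k+1] * sumTo (suc k) f              ≈⟨ sumTo-*ˡ (suc k) [k+1] f ⟩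
    sumTo (suc k) (λ i → [k+1] * f i)    ≈⟨ sumTo-cong≤ (suc k) split ⟩
    sumTo (suc k) (λ i → X i + Y i)      ≈⟨ sumTo-+ (suc k) X Y ⟩
    sumTo (suc k) X + sumTo (suc k) Y    ≈⟨ +-cong (+-congˡ X-last) (sumTo-suc-head k Y) ⟩
    (sumTo k X + 0#) + (Y 0 + sumTo k (λ j → Y (suc j)))
      ≈⟨ +-cong (+-identityʳ _) (trans (+-congʳ Y-first) (+-identityˡ _)) ⟩
    sumTo k X + sumTo k (λ j → Y (suc j)) ≈⟨ sumTo-+ k X (λ j → Y (suc j)) ⟨
    sumTo k (λ j → X j + Y (suc j))       ≈⟨ sumTo-zero k _ telescope ⟩
    0#                                    ∎)
    where
    [k+1] = qnum (suc k)
    f X Y : ℕ → Carrier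
    f i = stirlingCoeff i (suc k ∸ i) * 1#
    X i = qnum (suc k ∸ i) * stirlingCoeff i (suc k ∸ i)
    Y i = pow q (suc k ∸ i) * qnum i * stirlingCoeff i (suc k ∸ i)
    split : ∀ i → i ≤ suc k → [k+1] * f i ≈ X i + Y i
    split i i≤ = begin
      [k+1] * (stirlingCoeff i (suc k ∸ i) * 1#)
        ≈⟨ *-cong (reflexive (P.cong qnum (P.sym (ℕP.m∸n+n≡m i≤)))) (*-identityʳ _) ⟩
      qnum ((suc k ∸ i) ℕ.+ i) * stirlingCoeff i (suc k ∸ i)
        ≈⟨ *-congʳ (qnum-+ (suc k ∸ i) i) ⟩
      (qnum (suc k ∸ i) + pow q (suc k ∸ i) * qnum i) * stirlingCoeff i (suc k ∸ i)
        ≈⟨ distribʳ _ _ _ ⟩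
      X i + Y i ∎
    X-last : X (suc k) ≈ 0#
    X-last = trans (*-congʳ (trans (reflexive (P.cong qnum (ℕP.n∸n≡0 k))) qnum-0)) (zeroˡ _)
    Y-first : Y 0 ≈ 0#
    Y-first = trans (*-congʳ (trans (*-congˡ qnum-0) (zeroʳ _))) (zeroˡ _)
    telescope : ∀ j → j ≤ k → X j + Y (suc j) ≈ 0#
    telescope j j≤k rewrite ℕP.+-∸-assoc 1 j≤k = stirlingCoeff-cancel j (k ∸ j)

  stirlingSum≈ : ∀ n k → stirlingSum n k ≈ pow q (k C 2) * S n k
  stirlingSum≈ zero zero = trans (*-identityʳ _)
    (*-cong (*-identityˡ _) (trans (⁻¹-cong (nonzero-resp-≈ (sym (*-identityˡ _)) 1≉0) (*-identityˡ 1#)) 1⁻¹≈1))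
  stirlingSum≈ zero (suc k) = trans (stirlingSum-0-suc k) (sym (zeroʳ _))
  stirlingSum≈ (suc n) zero = begin
    stirlingCoeff 0 0 * (qnum 0 * pow (qnum 0) n) ≈⟨ *-congˡ (trans (*-congʳ qnum-0) (zeroˡ _)) ⟩
    stirlingCoeff 0 0 * 0#                        ≈⟨ zeroʳ _ ⟩
    0#                                            ≈⟨ zeroʳ _ ⟨
    1# * 0#                                       ≈⟨ *-congˡ (trans (+-identityˡ _) (trans (*-congʳ qnum-0) (zeroˡ _))) ⟨
    1# * (0# + qnum 0 * S n zero)                 ∎
  stirlingSum≈ (suc n) (suc k) = begin
    sumTo k (λ i → stirlingCoeff i (suc k ∸ i) * (qnum i * pow (qnum i) n))
      + stirlingCoeff (suc k) (suc k ∸ suc k) * ([k+1] * pow [k+1] n)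
      ≈⟨ +-cong (sumTo-cong≤ k split) (x∙yz≈y∙xz _ _ _) ⟩
    sumTo k (λ i → [k+1] * T i + qk * U i) + [k+1] * T (suc k)
      ≈⟨ +-congʳ (trans (sumTo-+ k _ _) (+-cong (sym (sumTo-*ˡ k [k+1] T)) (sym (sumTo-*ˡ k qk U)))) ⟩
    ([k+1] * sumTo k T + qk * stirlingSum n k) + [k+1] * T (suc k)
      ≈⟨ solve 4 (λ a b c d → (a :* b :+ c) :+ a :* d := a :* (b :+ d) :+ c) refl [k+1] (sumTo k T) (qk * stirlingSum n k) (T (suc k)) ⟩
    [k+1] * stirlingSum n (suc k) + qk * stirlingSum n k
      ≈⟨ +-cong (*-congˡ (stirlingSum≈ n (suc k))) (*-congˡ (stirlingSum≈ n k)) ⟩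
    [k+1] * (pow q (suc k C 2) * S n (suc k)) + qk * (Qk * S n k)
      ≈⟨ +-congʳ (*-congˡ (*-congʳ (pow-q-suc-C2 k))) ⟩
    [k+1] * ((qk * Qk) * S n (suc k)) + qk * (Qk * S n k)
      ≈⟨ solve 5 (λ r qk Qk a b → r :* ((qk :* Qk) :* a) :+ qk :* (Qk :* b) := (qk :* Qk) :* (b :+ r :* a))
               refl [k+1] qk Qk (S n (suc k)) (S n k) ⟩
    (qk * Qk) * (S n k + [k+1] * S n (suc k)) ≈⟨ *-congʳ (pow-q-suc-C2 k) ⟨
    pow q (suc k C 2) * S (suc n) (suc k)     ∎
    where
    open import Algebra.Properties.CommutativeSemigroup *-commutativeSemigroup using (x∙yz≈y∙xz)
    [k+1] = qnum (suc k)
    qk = pow q k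
    Qk = pow q (k C 2)
    T U : ℕ → Carrier
    T i = stirlingCoeff i (suc k ∸ i) * pow (qnum i) n
    U i = stirlingCoeff i (k ∸ i) * pow (qnum i) n
    split : ∀ i → i ≤ k → stirlingCoeff i (suc k ∸ i) * (qnum i * pow (qnum i) n) ≈ [k+1] * T i + qk * U i
    split i i≤k = begin
      stirlingCoeff i (suc k ∸ i) * (qnum i * pow (qnum i) n) ≈⟨ *-assoc _ _ _ ⟨
      (stirlingCoeff i (suc k ∸ i) * qnum i) * pow (qnum i) n ≈⟨ *-congʳ (stirlingCoeff-recurrence i k i≤k) ⟩
      ([k+1] * stirlingCoeff i (suc k ∸ i) + qk * stirlingCoeff i (k ∸ i)) * pow (qnum i) n
        ≈⟨ trans (distribʳ _ _ _) (+-cong (*-assoc _ _ _) (*-assoc _ _ _)) ⟩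
      [k+1] * T i + qk * U i ∎

  explicitFormula : ∀ k → lhs1 k ≋ rhs1 k
  explicitFormula k n = sym (begin
    Qk ⁻¹ * sumTo k (λ i → (pow (- 1#) (k ∸ i) * pow q ((k ∸ i) C 2) * qbinom k i) * (pow (qnum i) n * fn))
      ≈⟨ *-congˡ (sumTo-cong k (λ i →
           solve 6 (λ σ Q fk D p fn → (σ :* Q :* (fk :* D)) :* (p :* fn) := (fk :* (σ :* Q :* D :* p)) :* fn)
                 refl _ _ _ _ _ _)) ⟩
    Qk ⁻¹ * sumTo k (λ i → (fk * (stirlingCoeff i (k ∸ i) * pow (qnum i) n)) * fn)
      ≈⟨ *-congˡ (sym (sumTo-*ʳ k fn _)) ⟩
    Qk ⁻¹ * (sumTo k (λ i → fk * (stirlingCoeff i (k ∸ i) * pow (qnum i) n)) * fn)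
      ≈⟨ *-congˡ (*-congʳ (sym (sumTo-*ˡ k fk _))) ⟩
    Qk ⁻¹ * ((fk * stirlingSum n k) * fn) ≈⟨ *-congˡ (*-congʳ (*-congˡ (stirlingSum≈ n k))) ⟩
    Qk ⁻¹ * ((fk * (Qk * S n k)) * fn)
      ≈⟨ solve 5 (λ Qi Qk fk s fn → Qi :* ((fk :* (Qk :* s)) :* fn) := (Qi :* Qk) :* ((fk :* s) :* fn)) refl _ _ _ _ _ ⟩
    (Qk ⁻¹ * Qk) * ((fk * S n k) * fn) ≈⟨ *-congʳ (inverseˡ Qk (pow-nonzero q≉0 (k C 2))) ⟩
    1# * ((fk * S n k) * fn)           ≈⟨ *-identityˡ _ ⟩
    (fk * S n k) * fn                  ∎)
    where
    Qk = pow q (k C 2)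
    fk = qfact k
    fn = qfact n ⁻¹

module PowerSeries {c ℓ : Level} (F : QSetting c ℓ) where
  open QSetting F
  open Ops F
  open QNumbers F
  open FiniteSums F
  open import Relation.Binary.Reasoning.Setoid setoid

  oneS : Series
  oneS zero    = 1#
  oneS (suc _) = 0#

  shiftS : Series → Series
  shiftS f zero    = 0#
  shiftS f (suc m) = f m

  addS : Series → Series → Series
  addS f g m = f m + g m

  mulS-cong : ∀ {f f′ g g′} → f ≋ f′ → g ≋ g′ → mulS f g ≋ mulS f′ g′
  mulS-cong f≋f′ g≋g′ m = sumTo-cong m (λ j → *-cong (f≋f′ j) (g≋g′ (m ∸ j)))

  mulS-comm : ∀ f g → mulS f g ≋ mulS g f
  mulS-comm f g m = trans (sumTo-reverse m _) (sumTo-cong≤ m (λ j j≤m →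
    trans (*-comm _ _) (*-congʳ (reflexive (P.cong g (ℕP.m∸[m∸n]≡n j≤m))))))

  mulS-distribʳ : ∀ f g h → mulS (addS f g) h ≋ addS (mulS f h) (mulS g h)
  mulS-distribʳ f g h m = trans (sumTo-cong m (λ j → distribʳ _ _ _)) (sumTo-+ m _ _)

  mulS-distribˡ : ∀ f g h → mulS f (addS g h) ≋ addS (mulS f g) (mulS f h)
  mulS-distribˡ f g h m = trans (mulS-comm f (addS g h) m)
    (trans (mulS-distribʳ g h f m) (+-cong (mulS-comm g f m) (mulS-comm h f m)))

  mulS-scaleˡ : ∀ a f g → mulS (scale a f) g ≋ scale a (mulS f g)
  mulS-scaleˡ a f g m = trans (sumTo-cong m (λ j → *-assoc _ _ _)) (sym (sumTo-*ˡ m a _))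

  mulS-scaleʳ : ∀ a f g → mulS f (scale a g) ≋ scale a (mulS f g)
  mulS-scaleʳ a f g m = trans (mulS-comm f (scale a g) m)
    (trans (mulS-scaleˡ a g f m) (*-congˡ (mulS-comm g f m)))

  mulS-shiftˡ : ∀ f g → mulS (shiftS f) g ≋ shiftS (mulS f g)
  mulS-shiftˡ f g zero    = zeroˡ _
  mulS-shiftˡ f g (suc m) = trans (sumTo-suc-head m _) (trans (+-congʳ (zeroˡ _)) (+-identityˡ _))

  mulS-shiftʳ : ∀ f g → mulS f (shiftS g) ≋ shiftS (mulS f g)
  mulS-shiftʳ f g zero    = trans (mulS-comm f (shiftS g) 0) (mulS-shiftˡ g f 0)
  mulS-shiftʳ f g (suc m) = trans (mulS-comm f (shiftS g) (suc m))
    (trans (mulS-shiftˡ g f (suc m)) (mulS-comm g f m))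

  mulS-identityʳ : ∀ f → mulS f oneS ≋ f
  mulS-identityʳ f m = trans (mulS-comm f oneS m) (identityˡ m)
    where
    identityˡ : mulS oneS f ≋ f
    identityˡ zero    = *-identityˡ _
    identityˡ (suc m) = trans (sumTo-suc-head m _)
      (trans (+-cong (*-identityˡ _) (sumTo-zero m _ (λ i _ → zeroˡ _))) (+-identityʳ _))

  shiftS-cong : ∀ {f g} → f ≋ g → shiftS f ≋ shiftS g
  shiftS-cong f≋g zero    = refl
  shiftS-cong f≋g (suc m) = f≋g m

  linS≋ : ∀ a → linS a ≋ addS (scale a oneS) (shiftS oneS)
  linS≋ a zero          = sym (trans (+-identityʳ _) (*-identityʳ _))
  linS≋ a (suc zero)    = sym (trans (+-congʳ (zeroʳ _)) (+-identityˡ _))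
  linS≋ a (suc (suc m)) = sym (trans (+-identityʳ _) (zeroʳ _))

  mulS-linS : ∀ f a → mulS f (linS a) ≋ addS (scale a f) (shiftS f)
  mulS-linS f a m = begin
    mulS f (linS a) m                                ≈⟨ mulS-cong (λ _ → refl) (linS≋ a) m ⟩
    mulS f (addS (scale a oneS) (shiftS oneS)) m     ≈⟨ mulS-distribˡ f (scale a oneS) (shiftS oneS) m ⟩
    mulS f (scale a oneS) m + mulS f (shiftS oneS) m ≈⟨ +-cong (mulS-scaleʳ a f oneS m) (mulS-shiftʳ f oneS m) ⟩
    a * mulS f oneS m + shiftS (mulS f oneS) m       ≈⟨ +-cong (*-congˡ (mulS-identityʳ f m))
                                                               (shiftS-cong (mulS-identityʳ f) m) ⟩
    a * f m + shiftS f m                             ∎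

  mulS-assoc-linS : ∀ g P a → mulS g (mulS P (linS a)) ≋ mulS (addS (scale a g) (shiftS g)) P
  mulS-assoc-linS g P a m = begin
    mulS g (mulS P (linS a)) m                    ≈⟨ mulS-cong (λ _ → refl) (mulS-linS P a) m ⟩
    mulS g (addS (scale a P) (shiftS P)) m        ≈⟨ mulS-distribˡ g (scale a P) (shiftS P) m ⟩
    mulS g (scale a P) m + mulS g (shiftS P) m    ≈⟨ +-cong (mulS-scaleʳ a g P m) (mulS-shiftʳ g P m) ⟩
    a * mulS g P m + shiftS (mulS g P) m          ≈⟨ +-cong (mulS-scaleˡ a g P m) (mulS-shiftˡ g P m) ⟨
    mulS (scale a g) P m + mulS (shiftS g) P m    ≈⟨ mulS-distribʳ _ _ P m ⟨
    mulS (addS (scale a g) (shiftS g)) P m        ∎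

  invApprox-top : ∀ f m → invApprox f (suc m) (suc m) P.≡
    - (f 0 ⁻¹ * sumTo m (λ l → f (suc m ∸ l) * invApprox f m l))
  invApprox-top f m with suc m ≤? m
  ... | yes 1+m≤m = ⊥-elim (ℕP.n≮n m 1+m≤m)
  ... | no _      = P.refl

  invApprox-stable : ∀ f m j → j ≤ m → invApprox f m j P.≡ invS f j
  invApprox-stable f zero    .zero z≤n = P.refl
  invApprox-stable f (suc m) j    j≤ with j ≤? m
  ... | yes j≤m = invApprox-stable f m j j≤m
  ... | no j≰m with ℕP.≤-antisym j≤ (ℕP.≰⇒> j≰m)
  ...   | P.refl = P.sym (invApprox-top f m)

  invS-unique : ∀ f g → Nonzero (f 0) → mulS g f ≋ oneS → invS f ≋ g
  invS-unique f g f₀≉0 gf≋1 m = agree m m ℕP.≤-refl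
    where
    open import Algebra.Properties.Ring ring using (-‿distribʳ-*)
    open import Algebra.Properties.Group +-group using (inverseʳ-unique)
    agree : ∀ m j → j ≤ m → invS f j ≈ g j
    agree zero    .zero z≤n = ⁻¹-unique f₀≉0 (trans (*-comm _ _) (gf≋1 0))
    agree (suc m) j j≤ with ℕP.m≤n⇒m<n∨m≡n j≤
    ... | inj₁ j<1+m = agree m j (s≤s⁻¹ j<1+m)
    ... | inj₂ P.refl = begin
      invS f (suc m) ≡⟨ invApprox-top f m ⟩
      - (f 0 ⁻¹ * sumTo m (λ l → f (suc m ∸ l) * invApprox f m l))
        ≈⟨ -‿cong (*-congˡ (sumTo-cong≤ m (λ l l≤m →
             trans (*-comm _ _) (*-congʳ (trans (reflexive (invApprox-stable f m l l≤m)) (agree m l l≤m)))))) ⟩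
      - (f 0 ⁻¹ * Σ)           ≈⟨ -‿distribʳ-* _ _ ⟩
      f 0 ⁻¹ * - Σ             ≈⟨ *-congˡ (inverseʳ-unique _ _ last) ⟨
      f 0 ⁻¹ * (g (suc m) * f 0) ≈⟨ *-congˡ (*-comm _ _) ⟩
      f 0 ⁻¹ * (f 0 * g (suc m)) ≈⟨ *-assoc _ _ _ ⟨
      (f 0 ⁻¹ * f 0) * g (suc m) ≈⟨ *-congʳ (inverseˡ (f 0) f₀≉0) ⟩
      1# * g (suc m)           ≈⟨ *-identityˡ _ ⟩
      g (suc m)                ∎
      where
      Σ = sumTo m (λ l → g l * f (suc m ∸ l))
      last : Σ + g (suc m) * f 0 ≈ 0#
      last = trans (+-congˡ (*-congˡ (reflexive (P.cong f (P.sym (ℕP.n∸n≡0 m)))))) (gf≋1 (suc m))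

  mulS-mono : ∀ a i h k → i ≤ k → mulS (mono a i) h k ≈ a * h (k ∸ i)
  mulS-mono a i h k i≤k = trans (sumTo-single k i _ i≤k off-i) at-i
    where
    off-i : ∀ j → j P.≢ i → mono a i j * h (k ∸ j) ≈ 0#
    off-i j j≢i with j ℕ.≟ i
    ... | yes j≡i = ⊥-elim (j≢i j≡i)
    ... | no _    = zeroˡ _
    at-i : mono a i i * h (k ∸ i) ≈ a * h (k ∸ i)
    at-i with i ℕ.≟ i
    ... | yes _  = refl
    ... | no i≢i = ⊥-elim (i≢i P.refl)

module GeneratingFunction {c ℓ : Level} (F : QSetting c ℓ) where
  open QSetting F
  open Ops F
  open QNumbers F
  open FiniteSums F
  open PowerSeries F
  open ExplicitFormula F using (explicitFormula)
  open IntegerCoefficients cring using (solve; _:=_; con; _:+_; _:*_)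
  open import Relation.Binary.Reasoning.Setoid setoid

  linProd : ℕ → Series
  linProd i = prodS i (λ j → linS (pow q j))

  linProd-0-nonzero : ∀ i → Nonzero (linProd i 0)
  linProd-0-nonzero zero    = 1≉0
  linProd-0-nonzero (suc i) = *-nonzero (linProd-0-nonzero i) (pow-nonzero q≉0 (suc i))

  invDenom : ℕ → ℕ → ℕ → Carrier
  invDenom i m K = pow q i * pow q (K C 2) * (qfact i * qfact m)

  invDenom-nonzero : ∀ i m K → Nonzero (invDenom i m K)
  invDenom-nonzero i m K = *-nonzero (*-nonzero (pow-nonzero q≉0 i) (pow-nonzero q≉0 (K C 2)))
                                     (*-nonzero (qfact-nonzero i) (qfact-nonzero m))

  -- invCoeff i m = closedCoeff i m (i + m); the last argument is kept free so
  -- that i + m can be rewritten.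
  closedCoeff : ℕ → ℕ → ℕ → Carrier
  closedCoeff i m K = pow (- 1#) m * (pow q (m C 2) * qfact K) * invDenom i m K ⁻¹

  invCoeff : ℕ → Series
  invCoeff i m = closedCoeff i m (i ℕ.+ m)

  closedCoeff-step-0 : ∀ i → pow q (suc i) * closedCoeff (suc i) 0 (suc i) ≈ closedCoeff i 0 i
  closedCoeff-step-0 i = begin
    (q * qi) * (1# * (1# * (ni * fi)) * A⁻¹)
      ≈⟨ solve 5 (λ q qi ni fi A⁻¹ → (q :* qi) :* (con (+ 1) :* (con (+ 1) :* (ni :* fi)) :* A⁻¹)
                                      := con (+ 1) :* (con (+ 1) :* fi) :* ((q :* qi :* ni) :* A⁻¹))
               refl q qi ni fi A⁻¹ ⟩
    1# * (1# * fi) * ((q * qi * ni) * A⁻¹)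
      ≈⟨ *-congˡ (sym (⁻¹-factor (invDenom-nonzero i 0 i)
                        (*-nonzero (*-nonzero q≉0 (pow-nonzero q≉0 i)) (qnum-nonzero i)) A≈)) ⟩
    1# * (1# * fi) * invDenom i 0 i ⁻¹ ∎
    where
    qi = pow q i
    ni = qnum (suc i)
    fi = qfact i
    A⁻¹ = invDenom (suc i) 0 (suc i) ⁻¹
    A≈ : invDenom (suc i) 0 (suc i) ≈ invDenom i 0 i * (q * qi * ni)
    A≈ = trans (*-congʳ (*-congˡ (pow-q-suc-C2 i)))
      (solve 5 (λ q qi Qi ni fi → (q :* qi) :* (qi :* Qi) :* ((ni :* fi) :* con (+ 1))
                                  := qi :* Qi :* (fi :* con (+ 1)) :* (q :* qi :* ni))
             refl q qi (pow q (i C 2)) ni fi)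

  closedCoeff-step : ∀ i m →
    pow q (suc i) * closedCoeff (suc i) (suc m) (suc (suc (i ℕ.+ m))) + closedCoeff (suc i) m (suc (i ℕ.+ m))
      ≈ closedCoeff i (suc m) (suc (i ℕ.+ m))
  closedCoeff-step i m = begin
    (q * qi) * (- 1# * σ * (pow q (suc m C 2) * (qnum (suc K′) * f)) * A⁻¹)
      + σ * (Q * f) * invDenom (suc i) m K′ ⁻¹
      ≈⟨ +-cong (*-congˡ (*-congʳ (*-congˡ (*-cong (pow-q-suc-C2 m) (*-congʳ [K′+1]≈)))))
                (*-congˡ (⁻¹-factor (invDenom-nonzero (suc i) m K′) (*-nonzero T≉0 (qnum-nonzero m)) A≈B*)) ⟩
    (q * qi) * (- 1# * σ * ((qm * Q) * ((nm + (q * qm) * ni) * f)) * A⁻¹) + σ * (Q * f) * ((T * nm) * A⁻¹)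
      ≈⟨ solve 9 (λ q qi σ qm Q nm ni f A⁻¹ →
           (q :* qi) :* (con -[1+ 0 ] :* σ :* ((qm :* Q) :* ((nm :+ (q :* qm) :* ni) :* f)) :* A⁻¹)
             :+ σ :* (Q :* f) :* (((q :* (qi :* qm)) :* nm) :* A⁻¹)
           := con -[1+ 0 ] :* σ :* ((qm :* Q) :* f) :* ((q :* (q :* (qi :* qm)) :* ni) :* A⁻¹))
           refl q qi σ qm Q nm ni f A⁻¹ ⟩
    - 1# * σ * ((qm * Q) * f) * ((q * T * ni) * A⁻¹)
      ≈⟨ *-cong (*-congˡ (*-congʳ (sym (pow-q-suc-C2 m))))
                (sym (⁻¹-factor (invDenom-nonzero i (suc m) K′) (*-nonzero (*-nonzero q≉0 T≉0) (qnum-nonzero i)) A≈C*)) ⟩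
    - 1# * σ * (pow q (suc m C 2) * f) * invDenom i (suc m) K′ ⁻¹ ∎
    where
    K′ = suc (i ℕ.+ m)
    qi = pow q i
    qm = pow q m
    σ = pow (- 1#) m
    Q = pow q (m C 2)
    nm = qnum (suc m)
    ni = qnum (suc i)
    f = qfact K′
    T = q * (qi * qm)
    T≉0 : Nonzero T
    T≉0 = *-nonzero q≉0 (*-nonzero (pow-nonzero q≉0 i) (pow-nonzero q≉0 m))
    A = invDenom (suc i) (suc m) (suc K′)
    A⁻¹ = A ⁻¹
    [K′+1]≈ : qnum (suc K′) ≈ nm + (q * qm) * ni
    [K′+1]≈ = trans (reflexive (P.cong qnum (P.sym (P.trans (ℕP.+-comm (suc m) (suc i)) (P.cong suc (ℕP.+-suc i m))))))
                    (qnum-+ (suc m) (suc i))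
    A≈ : A ≈ (q * qi) * (T * pow q (K′ C 2)) * ((ni * qfact i) * (nm * qfact m))
    A≈ = *-congʳ (*-congˡ (trans (pow-q-suc-C2 K′) (*-congʳ (*-congˡ (pow-+ q i m)))))
    A≈B* : A ≈ invDenom (suc i) m K′ * (T * nm)
    A≈B* = trans A≈ (solve 8 (λ q qi T Q′ ni fi nm fm →
             (q :* qi) :* (T :* Q′) :* ((ni :* fi) :* (nm :* fm)) := (q :* qi) :* Q′ :* ((ni :* fi) :* fm) :* (T :* nm))
             refl q qi T (pow q (K′ C 2)) ni (qfact i) nm (qfact m))
    A≈C* : A ≈ invDenom i (suc m) K′ * (q * T * ni)
    A≈C* = trans A≈ (solve 8 (λ q qi T Q′ ni fi nm fm →
             (q :* qi) :* (T :* Q′) :* ((ni :* fi) :* (nm :* fm)) := qi :* Q′ :* (fi :* (nm :* fm)) :* (q :* T :* ni))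
             refl q qi T (pow q (K′ C 2)) ni (qfact i) nm (qfact m))

  invCoeff-recurrence : ∀ i →
    addS (scale (pow q (suc i)) (invCoeff (suc i))) (shiftS (invCoeff (suc i))) ≋ invCoeff i
  invCoeff-recurrence i zero    rewrite ℕP.+-identityʳ i = trans (+-identityʳ _) (closedCoeff-step-0 i)
  invCoeff-recurrence i (suc m) rewrite ℕP.+-suc i m      = closedCoeff-step i m

  invCoeff-0 : ∀ m → invCoeff 0 m ≈ pow (- 1#) m
  invCoeff-0 m = begin
    σ * (Q * f) * (1# * Q * (1# * f)) ⁻¹ ≈⟨ *-congˡ (⁻¹-cong (invDenom-nonzero 0 m m) (*-cong (*-identityˡ Q) (*-identityˡ f))) ⟩
    σ * (Q * f) * (Q * f) ⁻¹             ≈⟨ *-assoc _ _ _ ⟩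
    σ * ((Q * f) * (Q * f) ⁻¹)           ≈⟨ *-congˡ (inverseʳ _ (*-nonzero (pow-nonzero q≉0 (m C 2)) (qfact-nonzero m))) ⟩
    σ * 1#                               ≈⟨ *-identityʳ _ ⟩
    σ                                    ∎
    where
    σ = pow (- 1#) m
    Q = pow q (m C 2)
    f = qfact m

  invCoeff-*-linProd : ∀ i → mulS (invCoeff i) (linProd i) ≋ oneS
  invCoeff-*-linProd zero m = trans (mulS-linS (invCoeff 0) 1# m) (base m)
    where
    base : ∀ m → 1# * invCoeff 0 m + shiftS (invCoeff 0) m ≈ oneS m
    base zero    = trans (+-identityʳ _) (trans (*-identityˡ _) (invCoeff-0 0))
    base (suc m) = trans (+-cong (trans (*-identityˡ _) (invCoeff-0 (suc m))) (invCoeff-0 m))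
      (solve 1 (λ σ → con -[1+ 0 ] :* σ :+ σ := con (+ 0)) refl _)
  invCoeff-*-linProd (suc i) m = begin
    mulS (invCoeff (suc i)) (linProd (suc i)) m
      ≈⟨ mulS-assoc-linS (invCoeff (suc i)) (linProd i) (pow q (suc i)) m ⟩
    mulS (addS (scale (pow q (suc i)) (invCoeff (suc i))) (shiftS (invCoeff (suc i)))) (linProd i) m
      ≈⟨ mulS-cong {g = linProd i} (invCoeff-recurrence i) (λ _ → refl) m ⟩
    mulS (invCoeff i) (linProd i) m ≈⟨ invCoeff-*-linProd i m ⟩
    oneS m ∎

  invS-linProd : ∀ i → invS (linProd i) ≋ invCoeff i
  invS-linProd i = invS-unique (linProd i) (invCoeff i) (linProd-0-nonzero i) (invCoeff-*-linProd i)

  pow-q-*-invCoeff : ∀ i k → i ≤ k → pow q i * invCoeff i (k ∸ i)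
    ≈ pow q (k C 2) ⁻¹ * ((pow (- 1#) (k ∸ i) * pow q ((k ∸ i) C 2)) * qbinom k i)
  pow-q-*-invCoeff i k i≤k with ℕP.m≤n⇒∃[o]m+o≡n i≤k
  ... | m , P.refl rewrite ℕP.m+n∸m≡n i m = begin
    qi * (σ * (Q * f) * (qi * QK * D) ⁻¹)
      ≈⟨ *-congˡ (*-congˡ (trans (⁻¹-* (*-nonzero qi≉0 QK≉0) D≉0) (*-congʳ (⁻¹-* qi≉0 QK≉0)))) ⟩
    qi * (σ * (Q * f) * ((qi ⁻¹ * QK ⁻¹) * D ⁻¹))
      ≈⟨ solve 7 (λ qi σ Q f qi⁻¹ QK⁻¹ D⁻¹ → qi :* (σ :* (Q :* f) :* ((qi⁻¹ :* QK⁻¹) :* D⁻¹))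
                                            := (qi :* qi⁻¹) :* (QK⁻¹ :* ((σ :* Q) :* (f :* D⁻¹))))
               refl qi σ Q f (qi ⁻¹) (QK ⁻¹) (D ⁻¹) ⟩
    (qi * qi ⁻¹) * (QK ⁻¹ * ((σ * Q) * (f * D ⁻¹))) ≈⟨ *-congʳ (inverseʳ qi qi≉0) ⟩
    1# * (QK ⁻¹ * ((σ * Q) * (f * D ⁻¹)))          ≈⟨ *-identityˡ _ ⟩
    QK ⁻¹ * ((σ * Q) * (f * D ⁻¹))                 ∎
    where
    qi = pow q i
    σ = pow (- 1#) m
    Q = pow q (m C 2)
    f = qfact (i ℕ.+ m)
    QK = pow q ((i ℕ.+ m) C 2)
    D = qfact i * qfact m
    qi≉0 = pow-nonzero q≉0 i
    QK≉0 = pow-nonzero q≉0 ((i ℕ.+ m) C 2)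
    D≉0 = *-nonzero (qfact-nonzero i) (qfact-nonzero m)

  generatingFunction : lhs2 ≋₂ rhs2
  generatingFunction n k = trans (explicitFormula k n) (sym (begin
    sumTo k (λ i → mulS (mono (pow q i) i) (invS (linProd i)) k * expq (qnum i) n)
      ≈⟨ sumTo-cong≤ k coefficient ⟩
    sumTo k (λ i → QK⁻¹ * (a i * expq (qnum i) n)) ≈⟨ sumTo-*ˡ k QK⁻¹ _ ⟨
    QK⁻¹ * sumTo k (λ i → a i * expq (qnum i) n)   ∎))
    where
    QK⁻¹ = pow q (k C 2) ⁻¹
    a : ℕ → Carrier
    a i = pow (- 1#) (k ∸ i) * pow q ((k ∸ i) C 2) * qbinom k i
    coefficient : ∀ i → i ≤ k →
      mulS (mono (pow q i) i) (invS (linProd i)) k * expq (qnum i) n ≈ QK⁻¹ * (a i * expq (qnum i) n)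
    coefficient i i≤k = trans (*-congʳ (begin
      mulS (mono (pow q i) i) (invS (linProd i)) k ≈⟨ mulS-mono (pow q i) i (invS (linProd i)) k i≤k ⟩
      pow q i * invS (linProd i) (k ∸ i)          ≈⟨ *-congˡ (invS-linProd i (k ∸ i)) ⟩
      pow q i * invCoeff i (k ∸ i)                ≈⟨ pow-q-*-invCoeff i k i≤k ⟩
      QK⁻¹ * a i                                  ∎)) (*-assoc _ _ _)

theorem4p2 : ∀ {c ℓ : Level} (F : QSetting c ℓ) →
    (∀ (k : ℕ) → Ops._≋_ F (Ops.lhs1 F k) (Ops.rhs1 F k))
    × Ops._≋₂_ F (Ops.lhs2 F) (Ops.rhs2 F)
theorem4p2 F = ExplicitFormula.explicitFormula F , GeneratingFunction.generatingFunction F
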